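{- Let $k \ge 4$ and let $G$ be a graph in the class $\mathcal{G}_1(i_1,\dots,i_{k-3})$ for some $(k-3)$-tuple $(i_1,\dots,i_{k-3}) \in \{0,1\}^{k-3}$ with exactly one entry equal to $1$. Then $G$ is traceable.
   Context: Graphs are finite and simple. The class $\mathcal{B}_1$: take $m\ge 2$ vertex-disjoint stars $G_i\cong K_{1,n_i}$ ($n_i\ge1$) with centers $s^i_0$ and leaves $s^i_1,\dots,s^i_{n_i}$, and a possibly empty set $S''$ of isolated vertices; let $S'$ be the set of all leaves and $T$ the disjoint union of the stars and $S''$; a graph $B\in\mathcal{B}_1$ is obtained from the complement $\overline{T}$ by adding a new vertex $b$ (the head) adjacent to every vertex of $S'$. The class $\mathcal{G}_1(i_1,\dots,i_{k-3})$, where $i_\ell=1$ is the unique nonzero entry: if $1\le \ell\le k-4$, a graph $G$ in the class is obtained from vertex-disjoint paths $c_0c_1\dots c_{\ell-1}$ and $c_\ell c_{\ell+1}\dots c_{k-4}$, a complete graph $K_{n_\ell}$ ($n_\ell\ge1$) and a graph $B\in\mathcal{B}_1$ with head $b$, by joining each of $c_{\ell-1}$ and $c_\ell$ to every vertex of $K_{n_\ell}$ and adding the edge $c_{k-4}b$. If $\ell=k-3$, $G$ is obtained from a path $c_0c_1\dots c_{k-4}$, a complete graph $K_{n_{k-3}}$ ($n_{k-3}\ge 1$) and $B\in\mathcal{B}_1$ with head $b$, by joining each of $c_{k-4}$ and $b$ to every vertex of $K_{n_{k-3}}$. A graph is traceable if it has a hamiltonian path. -}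

module Defs where

open import Data.Nat using (ℕ; suc; _∸_; _<_)
open import Data.Fin using (Fin; toℕ)
open import Data.Product using (Σ; _×_)
open import Data.Sum using (_⊎_)
open import Data.List using (List)
open import Data.List.Membership.Propositional using (_∈_)
open import Data.List.Relation.Unary.Unique.Propositional using (Unique)
open import Data.List.Relation.Unary.Linked using (Linked)
open import Relation.Binary.PropositionalEquality using (_≡_; _≢_)
open import Relation.Nullary using (¬_)

record Graph : Set₁ where
  field
    V   : Set
    Adj : V → V → Set

Traceable : Graph → Set
Traceable G = Σ (List V) λ xs → Unique xs × (∀ v → v ∈ xs) × Linked Adj xs
  where open Graph G

-- The forest T: m stars G_i ≅ K_{1,ns i} plus s isolated vertices (S'').

data TV (m : ℕ) (ns : Fin m → ℕ) (s : ℕ) : Set where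
  ctr  : Fin m → TV m ns s
  leaf : (i : Fin m) → Fin (ns i) → TV m ns s
  iso  : Fin s → TV m ns s

data StarEdge {m : ℕ} {ns : Fin m → ℕ} {s : ℕ} : TV m ns s → TV m ns s → Set where
  ce : ∀ i j → StarEdge (ctr i) (leaf i j)
  ec : ∀ i j → StarEdge (leaf i j) (ctr i)

-- Vertices of a graph in G_1(i_1,...,i_{k-3}) with i_ℓ = 1:
-- path vertices c_0 .. c_{k-4}, the clique K_{nℓ}, the head b, and T.

data Vtx (k nℓ m : ℕ) (ns : Fin m → ℕ) (s : ℕ) : Set where
  c  : Fin (k ∸ 3) → Vtx k nℓ m ns s
  q  : Fin nℓ → Vtx k nℓ m ns s
  hd : Vtx k nℓ m ns s
  t  : TV m ns s → Vtx k nℓ m ns s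

data Arc (k ℓ nℓ m : ℕ) (ns : Fin m → ℕ) (s : ℕ) :
         Vtx k nℓ m ns s → Vtx k nℓ m ns s → Set where
  -- path edges c_a c_{a+1}, except c_{ℓ-1} c_ℓ (absent as a path edge;
  -- when ℓ = k-3 there is no vertex c_ℓ so this exclusion is vacuous)
  path : ∀ a b → toℕ b ≡ suc (toℕ a) → toℕ b ≢ ℓ → Arc k ℓ nℓ m ns s (c a) (c b)
  clq  : ∀ x y → x ≢ y → Arc k ℓ nℓ m ns s (q x) (q y)
  -- c_{ℓ-1} and c_ℓ joined to every vertex of K_{nℓ}
  -- (for ℓ = k-3 only c_{k-4} = c_{ℓ-1} exists)
  cq   : ∀ a x → (toℕ a ≡ ℓ ∸ 1 ⊎ toℕ a ≡ ℓ) → Arc k ℓ nℓ m ns s (c a) (q x)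
  hq   : ∀ x → ℓ ≡ k ∸ 3 → Arc k ℓ nℓ m ns s hd (q x)
  ch   : ∀ a → toℕ a ≡ k ∸ 4 → ℓ < k ∸ 3 → Arc k ℓ nℓ m ns s (c a) hd
  hl   : ∀ i j → Arc k ℓ nℓ m ns s hd (t (leaf i j))
  comp : ∀ x y → x ≢ y → ¬ StarEdge x y → Arc k ℓ nℓ m ns s (t x) (t y)

G₁ : (k ℓ nℓ m : ℕ) (ns : Fin m → ℕ) (s : ℕ) → Graph
G₁ k ℓ nℓ m ns s = record
  { V   = Vtx k nℓ m ns s
  ; Adj = λ x y → Arc k ℓ nℓ m ns s x y ⊎ Arc k ℓ nℓ m ns s y x
  }

{-# OPTIONS --safe #-}
-- The hamiltonian path is c_0 … c_{ℓ-1}, K_{nℓ}, c_ℓ … c_{k-4}, b, followed by a hamiltonian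
-- path of the complement of T: every clique vertex sees c_{ℓ-1} and c_ℓ (or b when ℓ = k-3), and
-- b sees every leaf. Two distinct vertices are adjacent in the complement of T unless one is a
-- center and the other one of its leaves, so the order
--   leaves of star 0, centers of the other stars, center of star 0,
--   leaves of the other stars, isolated vertices
-- works: it starts at a leaf, no segment contains a star edge, and at each junction the two
-- vertices belong to different stars (here m ≥ 2 is used).
module Submission where

open import Defs
open import Data.Nat using (ℕ; zero; suc; _+_; _≤_; _<_; _∸_; z≤n; s≤s; z<s; _<?_)
open import Data.Nat.Properties
open import Data.Fin using (Fin; toℕ; fromℕ; fromℕ<) renaming (zero to fzero; suc to fsuc)
open import Data.Fin.Properties using (toℕ-fromℕ; toℕ-fromℕ<; toℕ-injective; toℕ<n)
open import Data.Product using (∃; _×_; _,_; proj₂)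
open import Data.Sum using (_⊎_; inj₁; inj₂)
open import Data.Maybe as Maybe using (just; nothing)
open import Data.Maybe.Relation.Binary.Connected
  using (Connected; just; just-nothing; nothing-just; nothing)
open import Data.List using (List; []; _∷_; _++_; [_]; map; concat; tabulate; head; last)
open import Data.List.Properties using (head-map)
open import Data.List.Relation.Unary.All as All using (All; []; _∷_)
import Data.List.Relation.Unary.All.Properties as All
open import Data.List.Relation.Unary.AllPairs using ([]; _∷_)
import Data.List.Relation.Unary.AllPairs.Properties as AllPairs
open import Data.List.Relation.Unary.Any using (here; there)
open import Data.List.Relation.Unary.Linked as Linked using (Linked; []; [-]; _∷_; _∷′_)
import Data.List.Relation.Unary.Linked.Properties as Linkedₚ
open import Data.List.Relation.Unary.Unique.Propositional using (Unique)
import Data.List.Relation.Unary.Unique.Propositional.Properties as Unique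
open import Data.List.Relation.Binary.Disjoint.Propositional using (Disjoint)
open import Data.List.Membership.Propositional using (_∈_)
open import Data.List.Membership.Propositional.Properties
  using (∈-++⁺ˡ; ∈-++⁺ʳ; ∈-tabulate⁺; ∈-tabulate⁻; ∈-concat⁺′; ∈-map⁺)
open import Relation.Binary.PropositionalEquality
  using (_≡_; _≢_; refl; sym; trans; cong; subst; module ≡-Reasoning)
open import Relation.Nullary using (¬_; yes; no; contradiction)
open import Function using (_∘_; _∋_)

module _ {A : Set} {R : A → A → Set} where

  last-connected : ∀ {xs y} → (∀ {x} → x ∈ xs → Connected R (just x) y) → Connected R (last xs) y
  last-connected {[]}    {just _}  _ = nothing-just
  last-connected {[]}    {nothing} _ = nothing
  last-connected {_ ∷ []}           h = h (here refl)
  last-connected {_ ∷ _ ∷ _}        h = last-connected (h ∘ there)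

  connected-head : ∀ {x ys} → All (R x) ys → Connected R (just x) (head ys)
  connected-head []      = just-nothing
  connected-head (r ∷ _) = just r

  tabulate-linked-successive : ∀ {n} {f : Fin n → A} →
    (∀ {i j} → toℕ j ≡ suc (toℕ i) → R (f i) (f j)) → Linked R (tabulate f)
  tabulate-linked-successive {zero}        h = []
  tabulate-linked-successive {suc zero}    h = [-]
  tabulate-linked-successive {suc (suc n)} h = h refl ∷ tabulate-linked-successive (h ∘ cong suc)

  last-tabulate-connected : ∀ {n} (f : Fin (suc n) → A) {my} →
    Connected R (just (f (fromℕ n))) my → Connected R (last (tabulate f)) my
  last-tabulate-connected {zero}  f r = r
  last-tabulate-connected {suc n} f r = last-tabulate-connected (f ∘ fsuc) r

  tabulate-linked-pairwise : ∀ {n} {f : Fin n → A} →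
    (∀ {i j} → i ≢ j → R (f i) (f j)) → Linked R (tabulate f)
  tabulate-linked-pairwise h = Linkedₚ.AllPairs⇒Linked (AllPairs.tabulate⁺ h)

  Unique⇒Linked : ∀ {P : A → Set} {xs} → (∀ {x y} → P x → P y → x ≢ y → R x y) →
    Unique xs → All P xs → Linked R xs
  Unique⇒Linked h []                       []                 = []
  Unique⇒Linked h (_ ∷ [])                 (_ ∷ [])           = [-]
  Unique⇒Linked h ((x≢y ∷ _) ∷ u@(_ ∷ _)) (px ∷ ps@(py ∷ _)) = h px py x≢y ∷ Unique⇒Linked h u ps

head-tabulate-++ : ∀ {A : Set} {n} (f : Fin n → A) ys → Fin n →
  ∃ λ i → head (tabulate f ++ ys) ≡ just (f i)
head-tabulate-++ f ys fzero    = fzero , refl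
head-tabulate-++ f ys (fsuc _) = fzero , refl

module _ {A : Set} (seg : A → ℕ) where

  Block : ℕ → List A → Set
  Block k xs = Unique xs × All (λ x → seg x ≡ k) xs

  data Segmented : ℕ → List A → Set where
    final : ∀ {k xs} → Block k xs → Segmented k xs
    block : ∀ {k xs ys} → Block k xs → Segmented (suc k) ys → Segmented k (xs ++ ys)

  tabulate-block : ∀ {n k} (f : Fin n → A) → (∀ {i j} → f i ≡ f j → i ≡ j) →
    (∀ i → seg (f i) ≡ k) → Block k (tabulate f)
  tabulate-block f f-injective f-seg = Unique.tabulate⁺ f-injective , All.tabulate⁺ f-seg

  segmented-≥ : ∀ {k xs} → Segmented k xs → All (λ x → k ≤ seg x) xs
  segmented-≥ (final (_ , s))    = All.map (≤-reflexive ∘ sym) s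
  segmented-≥ (block (_ , s) ss) = All.++⁺ (All.map (≤-reflexive ∘ sym) s)
                                           (All.map (≤-trans (n≤1+n _)) (segmented-≥ ss))

  segmented-unique : ∀ {k xs} → Segmented k xs → Unique xs
  segmented-unique (final (u , _))    = u
  segmented-unique (block (u , s) ss) = Unique.++⁺ u (segmented-unique ss) disjoint
    where
    disjoint : Disjoint _ _
    disjoint (x∈xs , x∈ys) =
      <-irrefl (sym (All.lookup s x∈xs)) (All.lookup (segmented-≥ ss) x∈ys)

offset : ∀ {n len} i → i + len ≤ n → Fin len → Fin n
offset i p j = fromℕ< (<-≤-trans (+-monoʳ-< i (toℕ<n j)) p)

module _ {n len i} (p : i + len ≤ n) where

  toℕ-offset : ∀ j → toℕ (offset i p j) ≡ i + toℕ j
  toℕ-offset j = toℕ-fromℕ< _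

  offset-injective : ∀ {j j′} → offset i p j ≡ offset i p j′ → j ≡ j′
  offset-injective {j} {j′} e = toℕ-injective (+-cancelˡ-≡ i _ _ (begin
    i + toℕ j           ≡⟨ toℕ-offset j ⟨
    toℕ (offset i p j)  ≡⟨ cong toℕ e ⟩
    toℕ (offset i p j′) ≡⟨ toℕ-offset j′ ⟩
    i + toℕ j′          ∎))
    where open ≡-Reasoning

  offset-surjective : ∀ {a} → i ≤ toℕ a → toℕ a < i + len → ∃ λ j → offset i p j ≡ a
  offset-surjective {a} i≤a a<i+len = j , toℕ-injective (begin
    toℕ (offset i p j) ≡⟨ toℕ-offset j ⟩
    i + toℕ j          ≡⟨ cong (i +_) (toℕ-fromℕ< a∸i<len) ⟩
    i + (toℕ a ∸ i)    ≡⟨ m+[n∸m]≡n i≤a ⟩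
    toℕ a              ∎)
    where
    open ≡-Reasoning
    a∸i<len : toℕ a ∸ i < len
    a∸i<len = subst (toℕ a ∸ i <_) (m+n∸m≡n i len) (∸-monoˡ-< a<i+len i≤a)
    j : Fin len
    j = fromℕ< a∸i<len

module Forest {m′ : ℕ} {ns : Fin (suc (suc m′)) → ℕ} {s : ℕ} where

  T : Set
  T = TV (suc (suc m′)) ns s

  Adjᶜ : T → T → Set
  Adjᶜ x y = x ≢ y × ¬ StarEdge x y

  leaves₀ centers⁺ leaves⁺ isolated order : List T
  leaves₀  = tabulate (leaf fzero)
  centers⁺ = tabulate (ctr ∘ fsuc)
  leaves⁺  = concat (tabulate λ i → tabulate (leaf (fsuc i)))
  isolated = tabulate iso
  order    = leaves₀ ++ centers⁺ ++ ctr fzero ∷ leaves⁺ ++ isolated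

  segment : T → ℕ
  segment (leaf fzero _)    = 0
  segment (ctr (fsuc _))    = 1
  segment (ctr fzero)       = 2
  segment (leaf (fsuc _) _) = 3
  segment (iso _)           = 4

  star-edge-crosses-segments : ∀ {x y} → StarEdge x y → segment x ≢ segment y
  star-edge-crosses-segments (ce fzero _)    ()
  star-edge-crosses-segments (ce (fsuc _) _) ()
  star-edge-crosses-segments (ec fzero _)    ()
  star-edge-crosses-segments (ec (fsuc _) _) ()

  segment-clique : ∀ {k x y} → segment x ≡ k → segment y ≡ k → x ≢ y → Adjᶜ x y
  segment-clique sx sy x≢y = x≢y , λ e → star-edge-crosses-segments e (trans sx (sym sy))

  leaves⁺-disjoint : ∀ {i j} → i ≢ j →
    Disjoint (tabulate (leaf {ns = ns} {s} (fsuc i))) (tabulate (leaf (fsuc j)))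
  leaves⁺-disjoint {i} {j} i≢j (x∈i , x∈j)
    with ∈-tabulate⁻ {f = leaf (fsuc i)} x∈i | ∈-tabulate⁻ {f = leaf (fsuc j)} x∈j
  ... | _ , refl | _ , refl = i≢j refl

  leaves₀-block : Block segment 0 leaves₀
  leaves₀-block = tabulate-block segment (leaf fzero) (λ { refl → refl }) (λ _ → refl)

  centers⁺-block : Block segment 1 centers⁺
  centers⁺-block = tabulate-block segment (ctr ∘ fsuc) (λ { refl → refl }) (λ _ → refl)

  leaves⁺-block : Block segment 3 leaves⁺
  leaves⁺-block =
    Unique.concat⁺ (All.tabulate⁺ λ i → Unique.tabulate⁺ {f = leaf (fsuc i)} λ { refl → refl })
                   (AllPairs.tabulate⁺ leaves⁺-disjoint) ,
    All.concat⁺ (All.tabulate⁺ λ i → All.tabulate⁺ {f = leaf (fsuc i)} λ _ → refl)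

  isolated-block : Block segment 4 isolated
  isolated-block = tabulate-block segment iso (λ { refl → refl }) (λ _ → refl)

  order-unique : Unique order
  order-unique = segmented-unique segment
    (block leaves₀-block (block centers⁺-block
      (block {xs = [ ctr fzero ]} ([] ∷ [] , refl ∷ [])
      (block leaves⁺-block (final isolated-block)))))

  block-linked : ∀ {k xs} → Block segment k xs → Linked Adjᶜ xs
  block-linked (u , s) = Unique⇒Linked segment-clique u s

  order-linked : Linked Adjᶜ order
  order-linked =
    Linkedₚ.++⁺ (block-linked leaves₀-block) (last-connected leaf₀-to-center⁺)
   (Linkedₚ.++⁺ (block-linked centers⁺-block) (last-connected center⁺-to-center₀)
   (center₀-to-rest ∷′
    Linkedₚ.++⁺ (block-linked leaves⁺-block) (last-connected leaf⁺-to-isolated)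
               (block-linked isolated-block)))
    where
    leaf₀-to-center⁺ : ∀ {x} → x ∈ leaves₀ → Connected Adjᶜ (just x) (just (ctr (fsuc fzero)))
    leaf₀-to-center⁺ x∈ with ∈-tabulate⁻ {f = leaf fzero} x∈
    ... | _ , refl = just ((λ ()) , (λ ()))

    center⁺-to-center₀ : ∀ {x} → x ∈ centers⁺ → Connected Adjᶜ (just x) (just (ctr fzero))
    center⁺-to-center₀ x∈ with ∈-tabulate⁻ {f = ctr ∘ fsuc} x∈
    ... | _ , refl = just ((λ ()) , (λ ()))

    center₀-to-rest : Connected Adjᶜ (just (ctr fzero)) (head (leaves⁺ ++ isolated))
    center₀-to-rest = connected-head (All.++⁺
      (All.concat⁺ (All.tabulate⁺ λ i → All.tabulate⁺ {f = leaf (fsuc i)} λ _ → (λ ()) , (λ ())))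
      (All.tabulate⁺ λ _ → (λ ()) , (λ ())))

    leaf⁺-to-isolated : ∀ {x} → x ∈ leaves⁺ → Connected Adjᶜ (just x) (head isolated)
    leaf⁺-to-isolated {x} x∈ = connected-head (All.tabulate⁺ λ _ → x≢iso , λ ())
      where
      x≢iso : ∀ {j} → x ≢ iso j
      x≢iso e with All.lookup (proj₂ leaves⁺-block) (subst (_∈ leaves⁺) e x∈)
      ... | ()

  order-complete : ∀ x → x ∈ order
  order-complete (leaf fzero j)    = ∈-++⁺ˡ (∈-tabulate⁺ j)
  order-complete (ctr (fsuc i))    = ∈-++⁺ʳ leaves₀ (∈-++⁺ˡ (∈-tabulate⁺ {f = ctr ∘ fsuc} i))
  order-complete (ctr fzero)       = ∈-++⁺ʳ leaves₀ (∈-++⁺ʳ centers⁺ (here refl))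
  order-complete (leaf (fsuc i) j) = ∈-++⁺ʳ leaves₀ (∈-++⁺ʳ centers⁺ (there
    (∈-++⁺ˡ (∈-concat⁺′ (∈-tabulate⁺ j) (∈-tabulate⁺ {f = λ i → tabulate (leaf (fsuc i))} i)))))
  order-complete (iso j)           = ∈-++⁺ʳ leaves₀ (∈-++⁺ʳ centers⁺ (there
    (∈-++⁺ʳ leaves⁺ (∈-tabulate⁺ j))))

  order-head : 0 < ns fzero → ∃ λ j → head order ≡ just (leaf fzero j)
  order-head 0<n = head-tabulate-++ (leaf fzero) _ (fromℕ< 0<n)

module Graph₁ (k′ ℓ′ nℓ′ m′ : ℕ) (ns : Fin (suc (suc m′)) → ℕ) (s : ℕ)
              (star₀-has-leaf : 0 < ns fzero) where
  open Forest {m′} {ns} {s}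

  -- k = 4 + k′, so the path is c_0 … c_k′ and its missing edge is c_ℓ′ c_ℓ.
  ℓ n : ℕ
  ℓ = suc ℓ′
  n = suc k′

  open Graph (G₁ (4 + k′) ℓ (suc nℓ′) (suc (suc m′)) ns s)

  -- the index of the block of the hamiltonian path containing a vertex
  rank : V → ℕ
  rank (c a) with toℕ a <? ℓ
  ... | yes _ = 0
  ... | no _  = 2
  rank (q _) = 1
  rank hd    = 3
  rank (t _) = 4

  c-injective : ∀ {a b : Fin n} → c a ≡ (V ∋ c b) → a ≡ b
  c-injective refl = refl

  run : ∀ i len → i + len ≤ n → List V
  run i len p = tabulate (c ∘ offset i p)

  -- a run c_i … c_{i+len-1} is a path provided it does not contain the missing edge
  run-linked : ∀ i len (p : i + len ≤ n) → i + len ≤ ℓ ⊎ ℓ ≤ i → Linked Adj (run i len p)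
  run-linked i len p avoids-cut = tabulate-linked-successive λ {j₀} {j} j≡1+j₀ →
    inj₁ (path _ _ (consecutive j₀ j j≡1+j₀) (avoids j₀ j j≡1+j₀ avoids-cut))
    where
    open ≡-Reasoning
    consecutive : ∀ j₀ j → toℕ j ≡ suc (toℕ j₀) → toℕ (offset i p j) ≡ suc (toℕ (offset i p j₀))
    consecutive j₀ j e = begin
      toℕ (offset i p j)       ≡⟨ toℕ-offset p j ⟩
      i + toℕ j                ≡⟨ cong (i +_) e ⟩
      i + suc (toℕ j₀)         ≡⟨ +-suc i (toℕ j₀) ⟩
      suc (i + toℕ j₀)         ≡⟨ cong suc (toℕ-offset p j₀) ⟨
      suc (toℕ (offset i p j₀)) ∎
    avoids : ∀ j₀ j → toℕ j ≡ suc (toℕ j₀) → _ ⊎ _ → toℕ (offset i p j) ≢ ℓ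
    avoids j₀ j _ (inj₁ before) = <⇒≢ (subst (_< ℓ) (sym (toℕ-offset p j))
                                   (<-≤-trans (+-monoʳ-< i (toℕ<n j)) before))
    avoids j₀ j e (inj₂ after)  = >⇒≢ (subst (ℓ <_) (sym (trans (toℕ-offset p j) (cong (i +_) e)))
                                   (≤-<-trans after (m<m+n i z<s)))

  run-block : ∀ i len (p : i + len ≤ n) {k} →
    (∀ {a} → i ≤ toℕ a → toℕ a < i + len → rank (c a) ≡ k) → Block rank k (run i len p)
  run-block i len p rank-c =
    tabulate-block rank (c ∘ offset i p) (offset-injective p ∘ c-injective) λ j →
      rank-c (subst (i ≤_) (sym (toℕ-offset p j)) (m≤m+n i (toℕ j)))
             (subst (_< i + len) (sym (toℕ-offset p j)) (+-monoʳ-< i (toℕ<n j)))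

  ∈-run : ∀ i len (p : i + len ≤ n) {a} → i ≤ toℕ a → toℕ a < i + len → c a ∈ run i len p
  ∈-run i len p i≤a a<i+len with offset-surjective p i≤a a<i+len
  ... | j , refl = ∈-tabulate⁺ j

  rank-before : ∀ {a} → toℕ a < ℓ → rank (c a) ≡ 0
  rank-before {a} a<ℓ with toℕ a <? ℓ
  ... | yes _   = refl
  ... | no a≮ℓ = contradiction a<ℓ a≮ℓ

  rank-after : ∀ {a} → ℓ ≤ toℕ a → rank (c a) ≡ 2
  rank-after {a} ℓ≤a with toℕ a <? ℓ
  ... | yes a<ℓ = contradiction ℓ≤a (<⇒≱ a<ℓ)
  ... | no _    = refl

  clique : List V
  clique = tabulate q

  clique-linked : Linked Adj clique
  clique-linked = tabulate-linked-pairwise λ x≢y → inj₁ (clq _ _ x≢y)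

  forest : List V
  forest = map t order

  forest-linked : Linked Adj forest
  forest-linked = Linkedₚ.map⁺ (Linked.map (λ (x≢y , ¬e) → inj₁ (comp _ _ x≢y ¬e)) order-linked)

  head-to-forest : Connected Adj (just hd) (head forest)
  head-to-forest with order-head star₀-has-leaf
  ... | j , e = subst (Connected Adj (just hd))
                      (sym (trans (head-map order) (cong (Maybe.map t) e)))
                      (just (inj₁ (hl fzero j)))

  clique-exit : ∀ r (split : ℓ + r ≡ n) {x} →
    Connected Adj (just (q x)) (head (run ℓ r (≤-reflexive split) ++ hd ∷ forest))
  -- r = 0 is the case ℓ = k-3: there is no c_ℓ, and the clique is joined to b instead
  clique-exit zero    split = just (inj₂ (hq _ (trans (sym (+-identityʳ ℓ)) split)))
  clique-exit (suc r) split =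
    just (inj₂ (cq _ _ (inj₂ (trans (toℕ-offset (≤-reflexive split) fzero) (+-identityʳ ℓ)))))

  run-exit : ∀ r (split : ℓ + r ≡ n) → Connected Adj (last (run ℓ r (≤-reflexive split))) (just hd)
  run-exit zero    _     = nothing-just
  run-exit (suc r) split = last-tabulate-connected (c ∘ offset ℓ (≤-reflexive split))
    (just (inj₁ (ch _ last≡k′ (s≤s (subst (ℓ ≤_) ℓ+r≡k′ (m≤m+n ℓ r))))))
    where
    ℓ+r≡k′ : ℓ + r ≡ k′
    ℓ+r≡k′ = suc-injective (trans (sym (+-suc ℓ r)) split)
    last≡k′ : toℕ (offset ℓ (≤-reflexive split) (fromℕ r)) ≡ k′
    last≡k′ = trans (toℕ-offset (≤-reflexive split) (fromℕ r))
                    (trans (cong (ℓ +_) (toℕ-fromℕ r)) ℓ+r≡k′)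

  module Path (r : ℕ) (split : ℓ + r ≡ n) where

    ℓ≤n : 0 + ℓ ≤ n
    ℓ≤n = subst (ℓ ≤_) split (m≤m+n ℓ r)

    before after hamiltonian : List V
    before      = run 0 ℓ ℓ≤n
    after       = run ℓ r (≤-reflexive split)
    hamiltonian = before ++ clique ++ after ++ hd ∷ forest

    hamiltonian-unique : Unique hamiltonian
    hamiltonian-unique = segmented-unique rank
      (block (run-block 0 ℓ ℓ≤n (λ _ → rank-before))
      (block (tabulate-block rank q (λ { refl → refl }) (λ _ → refl))
      (block (run-block ℓ r (≤-reflexive split) (λ ℓ≤a _ → rank-after ℓ≤a))
      (block {xs = [ hd ]} ([] ∷ [] , refl ∷ [])
      (final (Unique.map⁺ (λ { refl → refl }) order-unique ,
              All.map⁺ (All.universal (λ _ → refl) order)))))))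

    hamiltonian-complete : ∀ v → v ∈ hamiltonian
    hamiltonian-complete (c a) with toℕ a <? ℓ
    ... | yes a<ℓ = ∈-++⁺ˡ (∈-run 0 ℓ ℓ≤n z≤n a<ℓ)
    ... | no a≮ℓ  = ∈-++⁺ʳ before (∈-++⁺ʳ clique (∈-++⁺ˡ
      (∈-run ℓ r (≤-reflexive split) (≮⇒≥ a≮ℓ) (subst (toℕ a <_) (sym split) (toℕ<n a)))))
    hamiltonian-complete (q x) = ∈-++⁺ʳ before (∈-++⁺ˡ (∈-tabulate⁺ {f = q} x))
    hamiltonian-complete hd    = ∈-++⁺ʳ before (∈-++⁺ʳ clique (∈-++⁺ʳ after (here refl)))
    hamiltonian-complete (t x) = ∈-++⁺ʳ before (∈-++⁺ʳ clique (∈-++⁺ʳ after (there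
      (∈-map⁺ t (order-complete x)))))

    hamiltonian-linked : Linked Adj hamiltonian
    hamiltonian-linked =
      Linkedₚ.++⁺ (run-linked 0 ℓ ℓ≤n (inj₁ ≤-refl)) before-exit
     (Linkedₚ.++⁺ clique-linked (last-tabulate-connected q (clique-exit r split))
     (Linkedₚ.++⁺ (run-linked ℓ r (≤-reflexive split) (inj₂ ≤-refl)) (run-exit r split)
                  (head-to-forest ∷′ forest-linked)))
      where
      before-exit : Connected Adj (last before) (just (q fzero))
      before-exit = last-tabulate-connected (c ∘ offset 0 ℓ≤n)
        (just (inj₁ (cq _ fzero (inj₁ (trans (toℕ-offset ℓ≤n (fromℕ ℓ′)) (toℕ-fromℕ ℓ′))))))

lemma4p3 : (k ℓ nℓ m : ℕ) (ns : Fin m → ℕ) (s : ℕ) →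
           4 ≤ k → 1 ≤ ℓ → ℓ ≤ k ∸ 3 → 1 ≤ nℓ → 2 ≤ m → (∀ i → 1 ≤ ns i) →
           Traceable (G₁ k ℓ nℓ m ns s)
lemma4p3 (suc (suc (suc (suc k′)))) (suc ℓ′) (suc nℓ′) (suc (suc m′)) ns s
  (s≤s (s≤s (s≤s (s≤s z≤n)))) (s≤s z≤n) ℓ≤n (s≤s z≤n) (s≤s (s≤s z≤n)) nonempty
  with m≤n⇒∃[o]m+o≡n ℓ≤n
... | r , split = hamiltonian , hamiltonian-unique , hamiltonian-complete , hamiltonian-linked
  where
  open Graph₁ k′ ℓ′ nℓ′ m′ ns s (nonempty fzero)
  open Path r split
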